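{- Let $\mathcal C_n$ be the set of permutations in $\mathfrak S_n$ avoiding $2\text{ - }1\text{ - }3$ and $32\text{ - }1$. Label each $\pi\in\mathcal C_n$ by $(h(\pi),\pi_n)$. Then $1\in\mathcal C_1$ has label $(0,1)$, and every $\pi\in\mathcal C_n$ with label $(h,r)$ has children in $\mathcal C_{n+1}$ whose multiset of labels is $(h+1,h+1),(h+2,h+2),\dots,(r,r),(h,r+1)$.
   Context: $\mathfrak S_n$ is the set of permutations $\pi=\pi_1\cdots\pi_n$ of $\{1,\dots,n\}$. $\pi$ avoids $2\text{ - }1\text{ - }3$ if there are no $i<j<k$ with $\pi_j<\pi_i<\pi_k$; $\pi$ avoids $32\text{ - }1$ if there are no $i$ and $k>i+1$ with $\pi_k<\pi_{i+1}<\pi_i$. For $\pi\in\mathfrak S_n$ and $j\in\{1,\dots,n+1\}$, appending $j$ to $\pi$ gives the permutation of $\{1,\dots,n+1\}$ whose first $n$ entries are $\pi_i$ if $\pi_i<j$ and $\pi_i+1$ if $\pi_i\ge j$, and whose last entry is $j$. The children of $\pi\in\mathcal C_n$ are the permutations obtained by appending some $j$ to $\pi$ that lie in $\mathcal C_{n+1}$. $h(\pi)=0$ if $\pi=12\cdots n$, and otherwise $h(\pi)=\max\{\pi_i:i>1,\ \pi_{i-1}>\pi_i\}$. -}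

module Defs where

open import Data.Nat using (ℕ; zero; suc; _+_; _∸_; _<_; _≤_; _<ᵇ_; _⊔_)
open import Data.Bool using (if_then_else_)
open import Data.List using (List; []; _∷_; _++_; [_]; map; upTo; length; foldr)
open import Data.List.Properties using (≡-dec)
open import Data.Nat.Properties using (_≟_)
open import Data.List.Relation.Binary.Permutation.Propositional using (_↭_)
open import Data.Product using (Σ; ∃; _×_; _,_)
open import Relation.Nullary using (¬_; yes; no)
open import Relation.Binary.PropositionalEquality using (_≡_)

-- Permutations are one-line notation lists π₁ ⋯ πₙ of natural numbers.

idPerm : ℕ → List ℕ
idPerm n = map suc (upTo n)

IsPerm : ℕ → List ℕ → Set
IsPerm n π = π ↭ idPerm n

Avoids2-1-3 : List ℕ → Set
Avoids2-1-3 π = ¬ (Σ (List ℕ) λ as → Σ (List ℕ) λ bs → Σ (List ℕ) λ cs → Σ (List ℕ) λ ds →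
                   Σ ℕ λ a → Σ ℕ λ b → Σ ℕ λ c →
                   (π ≡ as ++ a ∷ bs ++ b ∷ cs ++ c ∷ ds) × b < a × a < c)

Avoids32-1 : List ℕ → Set
Avoids32-1 π = ¬ (Σ (List ℕ) λ as → Σ (List ℕ) λ bs → Σ (List ℕ) λ cs →
                  Σ ℕ λ a → Σ ℕ λ b → Σ ℕ λ c →
                  (π ≡ as ++ a ∷ b ∷ bs ++ c ∷ cs) × c < b × b < a)

C : ℕ → List ℕ → Set
C n π = IsPerm n π × Avoids2-1-3 π × Avoids32-1 π

append : ℕ → List ℕ → List ℕ
append j π = map (λ x → if x <ᵇ j then x else suc x) π ++ [ j ]

IsChild : ℕ → List ℕ → List ℕ → Set
IsChild n π σ = Σ ℕ λ j → (1 ≤ j) × (j ≤ suc n) × (σ ≡ append j π) × C (suc n) σ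

descentBottoms : List ℕ → List ℕ
descentBottoms (x ∷ y ∷ rest) =
  (if y <ᵇ x then [ y ] else []) ++ descentBottoms (y ∷ rest)
descentBottoms _ = []

maxList : List ℕ → ℕ
maxList = foldr _⊔_ 0

h : List ℕ → ℕ
h π with ≡-dec _≟_ π (idPerm (length π))
... | yes _ = 0
... | no  _ = maxList (descentBottoms π)

-- last entry πₙ (0 for the empty list, never used)
lastEntry : List ℕ → ℕ
lastEntry []           = 0
lastEntry (x ∷ [])     = x
lastEntry (_ ∷ y ∷ xs) = lastEntry (y ∷ xs)

label : List ℕ → ℕ × ℕ
label π = h π , lastEntry π

childLabels : ℕ → ℕ → List (ℕ × ℕ)
childLabels hh r = map (λ i → (hh + suc i , hh + suc i)) (upTo (r ∸ hh)) ++ [ (hh , suc r) ]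

module Submission where

-- Appending j to π shifts every entry ≥ j up by one (the map `shift j`) and puts j last.
-- Write h = h(π) and r = πₙ.  The whole proof rests on one characterisation:
--
--   for π ∈ 𝒞ₙ and 1 ≤ j ≤ n+1,  append j π ∈ 𝒞ₙ₊₁  ⇔  h < j ≤ r+1.
--
-- (⇒) If j ≤ h, the descent y b of π with bottom b = h becomes a 32-1 with the new last
-- entry j; if j > r+1, the entries r+1 … r followed by j form a 2-1-3.
-- (⇐) A new 2-1-3 or 32-1 must end with the appended j.  For a 32-1 y b … j, b is a descent
-- bottom with j < b, forcing j ≤ h.  For a 2-1-3 a b … j we get a < j ≤ r+1, so a ≤ r; a = r
-- contradicts distinctness and a < r makes a b … r a 2-1-3 in π.
-- Moreover h ≤ r since π avoids 32-1.  Finally h is the largest descent bottom, and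
-- appending j ∈ (h, r] creates the new descent bottom j, while j = r+1 creates none; so the
-- children have labels (j, j) for h < j ≤ r and (h, r+1) for j = r+1.

open import Defs
open import Data.Nat using (ℕ; zero; suc; _+_; _∸_; _<_; _≤_; _<ᵇ_; _⊔_; z≤n; s≤s)
open import Data.Nat.Properties
open import Data.Bool using (true; false; if_then_else_; T)
open import Data.Unit using (tt)
open import Data.Empty using (⊥; ⊥-elim)
open import Data.Sum using (_⊎_; inj₁; inj₂)
open import Data.List using (List; []; _∷_; map; _++_; [_]; upTo; applyUpTo; length)
open import Data.List.Properties
  using (map-++; ∷-injective; ++-identityʳ; ++-assoc; upTo-∷ʳ; map-∘; map-upTo; map-cong-local; ≡-dec)
open import Data.List.Membership.Propositional using (_∈_)
open import Data.List.Membership.Propositional.Properties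
  using (∈-map⁺; ∈-map⁻; ∈-upTo⁺; ∈-upTo⁻; ∈-++⁺ʳ; ∈-∃++)
open import Data.List.Relation.Unary.Any using (here; there)
open import Data.List.Relation.Unary.AllPairs using (_∷_)
import Data.List.Relation.Unary.All as All
open import Data.List.Relation.Unary.Unique.Propositional using (Unique)
import Data.List.Relation.Unary.Unique.Propositional.Properties as Unique
open import Data.List.Relation.Binary.Permutation.Propositional
  using (_↭_; swap; ↭-sym; ↭-reflexive; ↭-refl; ↭-trans; ↭⇒↭ₛ; module PermutationReasoning)
open import Data.List.Relation.Binary.Permutation.Propositional.Properties
  using (Any-resp-↭; ++⁺ˡ; ++⁺ʳ) renaming (map⁺ to ↭-map⁺)
import Data.List.Relation.Binary.Permutation.Setoid.Properties as SetoidPerm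
open import Data.Product using (Σ; _×_; _,_; proj₁; proj₂)
open import Function.Bundles using (_⇔_; mk⇔; Equivalence)
open import Relation.Nullary using (yes; no)
open import Relation.Binary.Definitions using (tri<; tri≈; tri>)
open import Relation.Binary.PropositionalEquality
  using (_≡_; refl; sym; trans; cong; cong₂; subst; setoid; module ≡-Reasoning)

shift : ℕ → ℕ → ℕ
shift j x = if x <ᵇ j then x else suc x

<ᵇ-true : ∀ {m n} → m < n → (m <ᵇ n) ≡ true
<ᵇ-true {zero}  {suc n} _       = refl
<ᵇ-true {suc m} {suc n} (s≤s p) = <ᵇ-true p

<ᵇ-false : ∀ {m n} → n ≤ m → (m <ᵇ n) ≡ false
<ᵇ-false {m}     {zero}  _       = refl
<ᵇ-false {suc m} {suc n} (s≤s p) = <ᵇ-false p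

shift-below : ∀ {j x} → x < j → shift j x ≡ x
shift-below p rewrite <ᵇ-true p = refl

shift-above : ∀ {j x} → j ≤ x → shift j x ≡ suc x
shift-above p rewrite <ᵇ-false p = refl

x≤shift : ∀ j x → x ≤ shift j x
x≤shift j x with x <ᵇ j
... | true  = ≤-refl
... | false = n≤1+n x

shift<⇒< : ∀ {j x} → shift j x < j → x < j
shift<⇒< {j} {x} p = ≤-<-trans (x≤shift j x) p

<shift⇒≤ : ∀ {j x} → j < shift j x → j ≤ x
<shift⇒≤ {j} {x} p with x <? j
... | yes x<j = ⊥-elim (<-asym x<j (subst (j <_) (shift-below x<j) p))
... | no  x≮j = ≮⇒≥ x≮j

shift-mono : ∀ {j x y} → x < y → shift j x < shift j y
shift-mono {j} {x} {y} p with x <? j | y <? j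
... | yes a | yes b rewrite shift-below a | shift-below b = p
... | yes a | no  b rewrite shift-below a | shift-above (≮⇒≥ b) = m<n⇒m<1+n p
... | no  a | yes b = ⊥-elim (<-irrefl refl (≤-<-trans (≮⇒≥ a) (<-trans p b)))
... | no  a | no  b rewrite shift-above (≮⇒≥ a) | shift-above (≮⇒≥ b) = s≤s p

shift-reflects : ∀ {j x y} → shift j x < shift j y → x < y
shift-reflects {j} {x} {y} p with <-cmp x y
... | tri< x<y _ _ = x<y
... | tri≈ _ refl _ = ⊥-elim (<-irrefl refl p)
... | tri> _ _ y<x = ⊥-elim (<-asym p (shift-mono {j} y<x))

-- Hence the shift does not change which adjacent pairs are descents.
shift-<ᵇ : ∀ j x y → (shift j x <ᵇ shift j y) ≡ (x <ᵇ y)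
shift-<ᵇ j x y with x <? y
... | yes p rewrite <ᵇ-true p = <ᵇ-true (shift-mono {j} p)
... | no  p rewrite <ᵇ-false (≮⇒≥ p) = <ᵇ-false (≮⇒≥ (λ q → p (shift-reflects {j} q)))

-- Where an occurrence `as ++ x ∷ rest` sits inside `map g p ++ [ j ]`: either it is the
-- appended j, or it is the image g y of an entry y of p.  Every pattern in an appended
-- permutation is analysed through this view.
data Occurrence {A B : Set} (g : A → B) (p : List A) (j : B) (as : List B) (x : B) (rest : List B) : Set where
  appended : as ≡ map g p → x ≡ j → rest ≡ [] → Occurrence g p j as x rest
  image    : (p₁ : List A) (y : A) (p₂ : List A) → p ≡ p₁ ++ y ∷ p₂ → as ≡ map g p₁ → x ≡ g y →
             rest ≡ map g p₂ ++ [ j ] → Occurrence g p j as x rest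

occurrence : ∀ {A B : Set} (g : A → B) p j as x rest → map g p ++ [ j ] ≡ as ++ x ∷ rest →
             Occurrence g p j as x rest
occurrence g []      j []           x rest refl = appended refl refl refl
occurrence g []      j (_ ∷ [])     x rest ()
occurrence g []      j (_ ∷ _ ∷ _)  x rest ()
occurrence g (y ∷ p) j []           x rest refl = image [] y p refl refl refl refl
occurrence g (y ∷ p) j (a ∷ as)     x rest eq with ∷-injective eq
... | y≡a , eq′ with occurrence g p j as x rest eq′
...   | appended e₁ e₂ e₃ = appended (cong₂ _∷_ (sym y≡a) e₁) e₂ e₃
...   | image p₁ z p₂ e₁ e₂ e₃ e₄ = image (y ∷ p₁) z p₂ (cong (y ∷_) e₁) (cong₂ _∷_ (sym y≡a) e₂) e₃ e₄

++-∷≢[] : ∀ {A : Set} (xs : List A) y ys → xs ++ y ∷ ys ≡ [] → ⊥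
++-∷≢[] []      y ys ()
++-∷≢[] (_ ∷ _) y ys ()

map-snoc₂ : ∀ {A B : Set} (g : A → B) p₁ y b q j →
            map g (p₁ ++ y ∷ b ∷ q) ++ [ j ] ≡ map g p₁ ++ g y ∷ g b ∷ map g q ++ j ∷ []
map-snoc₂ g []       y b q j = refl
map-snoc₂ g (x ∷ p₁) y b q j = cong (g x ∷_) (map-snoc₂ g p₁ y b q j)

map-snoc-last : ∀ {A B : Set} (g : A → B) xs a zs b j →
                map g (xs ++ a ∷ zs ++ [ b ]) ++ [ j ] ≡ map g xs ++ g a ∷ map g zs ++ g b ∷ [] ++ j ∷ []
map-snoc-last g []       a []       b j = refl
map-snoc-last g []       a (z ∷ zs) b j = cong (g a ∷_) (map-snoc-last g [] z zs b j)
map-snoc-last g (x ∷ xs) a zs       b j = cong (g x ∷_) (map-snoc-last g xs a zs b j)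

last-++ : ∀ xs (y : ℕ) ys → lastEntry (xs ++ y ∷ ys) ≡ lastEntry (y ∷ ys)
last-++ []            y ys = refl
last-++ (x ∷ [])      y ys = refl
last-++ (x ∷ x′ ∷ xs) y ys = last-++ (x′ ∷ xs) y ys

last-snoc : ∀ xs j → lastEntry (xs ++ [ j ]) ≡ j
last-snoc xs j = last-++ xs j []

last-split : ∀ y ys → Σ (List ℕ) λ zs → y ∷ ys ≡ zs ++ [ lastEntry (y ∷ ys) ]
last-split y []        = [] , refl
last-split y (y′ ∷ ys) with last-split y′ ys
... | zs , e = y ∷ zs , cong (y ∷_) e

last-map : ∀ g y ys → lastEntry (map g (y ∷ ys)) ≡ g (lastEntry (y ∷ ys))
last-map g y []        = refl
last-map g y (y′ ∷ ys) = last-map g y′ ys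

last-∈ : ∀ y ys → lastEntry (y ∷ ys) ∈ y ∷ ys
last-∈ y []        = here refl
last-∈ y (y′ ∷ ys) = there (last-∈ y′ ys)

-- h(π) is the largest descent bottom (0 if there is none); below we work with this form.
maxDescent : List ℕ → ℕ
maxDescent p = maxList (descentBottoms p)

newBottom : ℕ → ℕ → List ℕ
newBottom j r = if j <ᵇ r then [ j ] else []

maxList-++ : ∀ xs ys → maxList (xs ++ ys) ≡ maxList xs ⊔ maxList ys
maxList-++ []       ys = refl
maxList-++ (x ∷ xs) ys = trans (cong (x ⊔_) (maxList-++ xs ys)) (sym (⊔-assoc x _ _))

≤-maxList : ∀ {x xs} → x ∈ xs → x ≤ maxList xs
≤-maxList {x} {.x ∷ xs} (here refl) = m≤m⊔n x _
≤-maxList {x} {y ∷ xs}  (there m)   = ≤-trans (≤-maxList m) (m≤n⊔m y _)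

maxList-attained : ∀ xs → maxList xs ≡ 0 ⊎ maxList xs ∈ xs
maxList-attained []       = inj₁ refl
maxList-attained (x ∷ xs) with ⊔-sel x (maxList xs)
... | inj₁ e = inj₂ (here e)
... | inj₂ e with maxList-attained xs
...   | inj₁ e′ = inj₁ (trans e e′)
...   | inj₂ m  = inj₂ (there (subst (_∈ xs) (sym e) m))

data DescentAt (p : List ℕ) (z : ℕ) : Set where
  descentAt : (p₁ : List ℕ) (w : ℕ) (q : List ℕ) → p ≡ p₁ ++ w ∷ z ∷ q → z < w → DescentAt p z

descentAt-∷ : ∀ {p z} x → DescentAt p z → DescentAt (x ∷ p) z
descentAt-∷ x (descentAt p₁ w q e lt) = descentAt (x ∷ p₁) w q (cong (x ∷_) e) lt

∈-descentBottoms : ∀ p₁ y z q → z < y → z ∈ descentBottoms (p₁ ++ y ∷ z ∷ q)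
∈-descentBottoms []            y z q lt rewrite <ᵇ-true lt = here refl
∈-descentBottoms (x ∷ [])      y z q lt =
  ∈-++⁺ʳ (newBottom y x) (∈-descentBottoms [] y z q lt)
∈-descentBottoms (x ∷ x′ ∷ p₁) y z q lt =
  ∈-++⁺ʳ (newBottom x′ x) (∈-descentBottoms (x′ ∷ p₁) y z q lt)

descentBottoms-∈ : ∀ p z → z ∈ descentBottoms p → DescentAt p z
descentBottoms-∈ (x ∷ y ∷ rest) z m with y <ᵇ x in y<ᵇx | descentBottoms-∈ (y ∷ rest) z
descentBottoms-∈ (x ∷ y ∷ rest) z (here refl) | true  | _  = descentAt [] x rest refl (<ᵇ⇒< y x (subst T (sym y<ᵇx) tt))
descentBottoms-∈ (x ∷ y ∷ rest) z (there m)   | true  | ih = descentAt-∷ x (ih m)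
descentBottoms-∈ (x ∷ y ∷ rest) z m           | false | ih = descentAt-∷ x (ih m)

≤-maxDescent : ∀ p₁ y z q → z < y → z ≤ maxDescent (p₁ ++ y ∷ z ∷ q)
≤-maxDescent p₁ y z q lt = ≤-maxList (∈-descentBottoms p₁ y z q lt)

maxDescent-attained : ∀ p → maxDescent p ≡ 0 ⊎ DescentAt p (maxDescent p)
maxDescent-attained p with maxList-attained (descentBottoms p)
... | inj₁ e = inj₁ e
... | inj₂ m = inj₂ (descentBottoms-∈ p _ m)

descentBottoms-increasing : ∀ (f : ℕ → ℕ) m → (∀ i → f i ≤ f (suc i)) → descentBottoms (applyUpTo f m) ≡ []
descentBottoms-increasing f zero          mono = refl
descentBottoms-increasing f (suc zero)    mono = refl
descentBottoms-increasing f (suc (suc m)) mono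
  with f 1 <ᵇ f 0 | <ᵇ-false (mono 0) | descentBottoms-increasing (λ i → f (suc i)) (suc m) (λ i → mono (suc i))
... | .false | refl | noDescents = noDescents

h≡maxDescent : ∀ π → h π ≡ maxDescent π
h≡maxDescent π with ≡-dec _≟_ π (idPerm (length π))
... | no  _ = refl
... | yes e = sym (begin
  maxDescent π                                   ≡⟨ cong maxDescent e ⟩
  maxDescent (idPerm (length π))                 ≡⟨ cong (λ l → maxList (descentBottoms l)) (map-upTo suc (length π)) ⟩
  maxList (descentBottoms (applyUpTo suc (length π)))
                                                 ≡⟨ cong maxList (descentBottoms-increasing suc (length π) (λ i → n≤1+n (suc i))) ⟩
  0                                              ∎)
  where open ≡-Reasoning

map-shift-below : ∀ j xs → (∀ x → x ∈ xs → x < j) → map (shift j) xs ≡ xs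
map-shift-below j []       below = refl
map-shift-below j (x ∷ xs) below =
  cong₂ _∷_ (shift-below (below x (here refl))) (map-shift-below j xs (λ y m → below y (there m)))

unique-resp-↭ : ∀ {A : Set} {xs ys : List A} → xs ↭ ys → Unique xs → Unique ys
unique-resp-↭ {A} p = SetoidPerm.Unique-resp-↭ (setoid A) (↭⇒↭ₛ p)

idPerm-unique : ∀ n → Unique (idPerm n)
idPerm-unique n = Unique.map⁺ suc-injective (Unique.upTo⁺ n)

perm-unique : ∀ {n π} → IsPerm n π → Unique π
perm-unique {n} perm = unique-resp-↭ (↭-sym perm) (idPerm-unique n)

unique-middle∉ : ∀ {A : Set} (xs : List A) x ys → Unique (xs ++ x ∷ ys) → x ∈ ys → ⊥
unique-middle∉ []       x ys (x∉ys ∷ _) m = All.lookup x∉ys m refl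
unique-middle∉ (_ ∷ xs) x ys (_ ∷ u)    m = unique-middle∉ xs x ys u m

perm-bounds : ∀ {n π x} → IsPerm n π → x ∈ π → 1 ≤ x × x ≤ n
perm-bounds perm m with ∈-map⁻ suc (Any-resp-↭ perm m)
... | i , i∈ , refl = s≤s z≤n , ∈-upTo⁻ i∈

perm-∈ : ∀ {n π x} → IsPerm n π → 1 ≤ x → x ≤ n → x ∈ π
perm-∈ {x = suc i} perm _ le = Any-resp-↭ (↭-sym perm) (∈-map⁺ suc (∈-upTo⁺ le))

last≤n : ∀ {n π} → IsPerm n π → lastEntry π ≤ n
last≤n {π = []}     perm = z≤n
last≤n {π = x ∷ xs} perm = proj₂ (perm-bounds perm (last-∈ x xs))

idPerm-snoc : ∀ n → idPerm (suc n) ≡ idPerm n ++ [ suc n ]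
idPerm-snoc n = trans (cong (map suc) (sym (upTo-∷ʳ n))) (map-++ suc (upTo n) [ n ])

-- Appending j to 12⋯n gives a permutation of 1…n+1; by induction on n, moving the top
-- entry n+1 past j.
append-idPerm : ∀ n j → 1 ≤ j → j ≤ suc n → append j (idPerm n) ↭ idPerm (suc n)
append-idPerm zero    (suc zero)    _   _         = ↭-refl
append-idPerm zero    (suc (suc j)) _   (s≤s ())
append-idPerm (suc m) j             1≤j j≤ with m≤n⇒m<n∨m≡n j≤
... | inj₂ refl = ↭-reflexive (begin
  map (shift j) (idPerm (suc m)) ++ [ j ] ≡⟨ cong (_++ [ j ]) (map-shift-below j (idPerm (suc m))
                                             (λ x x∈ → s≤s (proj₂ (perm-bounds {suc m} ↭-refl x∈)))) ⟩
  idPerm (suc m) ++ [ j ]                 ≡⟨ sym (idPerm-snoc (suc m)) ⟩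
  idPerm (suc (suc m))                    ∎)
  where open ≡-Reasoning
... | inj₁ (s≤s j≤sm) = begin
  map (shift j) (idPerm (suc m)) ++ [ j ]     ≡⟨ split ⟩
  map (shift j) (idPerm m) ++ suc (suc m) ∷ j ∷ []
                                              ↭⟨ ++⁺ˡ (map (shift j) (idPerm m)) (swap (suc (suc m)) j ↭-refl) ⟩
  map (shift j) (idPerm m) ++ j ∷ suc (suc m) ∷ []
                                              ≡⟨ sym (++-assoc (map (shift j) (idPerm m)) [ j ] [ suc (suc m) ]) ⟩
  append j (idPerm m) ++ [ suc (suc m) ]      ↭⟨ ++⁺ʳ [ suc (suc m) ] (append-idPerm m j 1≤j j≤sm) ⟩
  idPerm (suc m) ++ [ suc (suc m) ]           ≡⟨ sym (idPerm-snoc (suc m)) ⟩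
  idPerm (suc (suc m))                        ∎
  where
  open PermutationReasoning
  split : map (shift j) (idPerm (suc m)) ++ [ j ] ≡ map (shift j) (idPerm m) ++ suc (suc m) ∷ j ∷ []
  split = trans (cong (λ t → map (shift j) t ++ [ j ]) (idPerm-snoc m))
         (trans (cong (_++ [ j ]) (map-++ (shift j) (idPerm m) [ suc m ]))
         (trans (++-assoc (map (shift j) (idPerm m)) [ shift j (suc m) ] [ j ])
                (cong (λ t → map (shift j) (idPerm m) ++ t ∷ j ∷ []) (shift-above j≤sm))))

append-IsPerm : ∀ {n π j} → IsPerm n π → 1 ≤ j → j ≤ suc n → IsPerm (suc n) (append j π)
append-IsPerm {n} {π} {j} perm 1≤j j≤ = ↭-trans (++⁺ʳ [ j ] (↭-map⁺ (shift j) perm)) (append-idPerm n j 1≤j j≤)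

-- All of a, b are old; if c
-- is old the pattern already lies in π, and if c = j then j < b forces the descent bottom b
-- to satisfy j ≤ b ≤ h(π), contradicting h(π) < j.
append-avoids32-1 : ∀ {π j} → Avoids32-1 π → maxDescent π < j → Avoids32-1 (append j π)
append-avoids32-1 {π} {j} avoids h<j (as , bs , cs , a , b , c , eq , c<b , b<a)
  with occurrence (shift j) π j as a (b ∷ bs ++ c ∷ cs) eq
... | appended _ _ ()
... | image p₁ y₁ p₂ refl _ refl rest₁ with occurrence (shift j) p₂ j [] b (bs ++ c ∷ cs) (sym rest₁)
...   | appended _ _ e = ++-∷≢[] bs c cs e
...   | image (_ ∷ _) _ _ _ () _ _
...   | image [] y₂ q₂ refl _ refl rest₂ with occurrence (shift j) q₂ j bs c cs (sym rest₂)
...     | appended _ refl _ =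
          <-irrefl refl (≤-<-trans (<shift⇒≤ {j} c<b)
                                   (≤-<-trans (≤-maxDescent p₁ y₁ y₂ q₂ (shift-reflects {j} b<a)) h<j))
...     | image s₁ y₃ s₂ refl _ refl _ =
          avoids (p₁ , s₁ , s₂ , y₁ , y₂ , y₃ , refl , shift-reflects {j} c<b , shift-reflects {j} b<a)

-- The 2-1-3 case with c = j: entries y₁ > y₂ of π with y₁ < j ≤ r+1, r = πₙ.  Then y₁ ≠ r by
-- distinctness, and y₁ < r makes y₁ y₂ … r a 2-1-3 in π (y₂ ≠ r since y₂ < y₁ < r).
no-2-1-with-last : ∀ p₁ y₁ q₁ y₂ q₂ {j} → Unique (p₁ ++ y₁ ∷ q₁ ++ y₂ ∷ q₂) →
                   j ≤ suc (lastEntry (p₁ ++ y₁ ∷ q₁ ++ y₂ ∷ q₂)) → Avoids2-1-3 (p₁ ++ y₁ ∷ q₁ ++ y₂ ∷ q₂) →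
                   y₂ < y₁ → y₁ < j → ⊥
no-2-1-with-last p₁ y₁ q₁ y₂ q₂ {j} distinct j≤r+1 avoids y₂<y₁ y₁<j
  with last-split y₂ q₂ | m≤n⇒m<n∨m≡n y₁≤r
  where
  r : ℕ
  r = lastEntry (y₂ ∷ q₂)
  r-is-last : lastEntry (p₁ ++ y₁ ∷ q₁ ++ y₂ ∷ q₂) ≡ r
  r-is-last = trans (last-++ p₁ y₁ (q₁ ++ y₂ ∷ q₂)) (last-++ (y₁ ∷ q₁) y₂ q₂)
  y₁≤r : y₁ ≤ r
  y₁≤r = ≤-pred (<-≤-trans y₁<j (subst (λ t → j ≤ suc t) r-is-last j≤r+1))
... | _ | inj₂ y₁≡r =
  unique-middle∉ p₁ y₁ (q₁ ++ y₂ ∷ q₂) distinct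
    (∈-++⁺ʳ q₁ (subst (_∈ y₂ ∷ q₂) (sym y₁≡r) (last-∈ y₂ q₂)))
... | [] , e | inj₁ y₁<r = <-irrefl (proj₁ (∷-injective e)) (<-trans y₂<y₁ y₁<r)
... | _ ∷ zs , e | inj₁ y₁<r =
  avoids (p₁ , q₁ , zs , [] , y₁ , y₂ , lastEntry (y₂ ∷ q₂) ,
          cong (λ t → p₁ ++ y₁ ∷ q₁ ++ y₂ ∷ t) (proj₂ (∷-injective e)) , y₂<y₁ , y₁<r)

-- (⇐, 2-1-3) A 2-1-3 in `append j π` either lies in π or ends with the appended j.
append-avoids2-1-3 : ∀ {π j} → Unique π → j ≤ suc (lastEntry π) → Avoids2-1-3 π → Avoids2-1-3 (append j π)
append-avoids2-1-3 {π} {j} distinct j≤r+1 avoids (as , bs , cs , ds , a , b , c , eq , b<a , a<c)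
  with occurrence (shift j) π j as a (bs ++ b ∷ cs ++ c ∷ ds) eq
... | appended _ _ e = ++-∷≢[] bs b (cs ++ c ∷ ds) e
... | image p₁ y₁ p₂ refl _ refl rest₁ with occurrence (shift j) p₂ j bs b (cs ++ c ∷ ds) (sym rest₁)
...   | appended _ _ e = ++-∷≢[] cs c ds e
...   | image q₁ y₂ q₂ refl _ refl rest₂ with occurrence (shift j) q₂ j cs c ds (sym rest₂)
...     | appended _ refl _ =
          no-2-1-with-last p₁ y₁ q₁ y₂ q₂ distinct j≤r+1 avoids (shift-reflects {j} b<a) (shift<⇒< {j} a<c)
...     | image s₁ y₃ s₂ refl _ refl _ =
          avoids (p₁ , q₁ , s₁ , s₂ , y₁ , y₂ , y₃ , refl , shift-reflects {j} b<a , shift-reflects {j} a<c)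

-- (⇒, 2-1-3) If j > r+1 where r = πₙ, the entry r+1 of π (occurring before r), then r,
-- then j form a 2-1-3 in `append j π`.
append-above-last+1 : ∀ xs r ys j → lastEntry (xs ++ suc r ∷ ys) ≡ r → suc r < j →
                      Avoids2-1-3 (append j (xs ++ suc r ∷ ys)) → ⊥
append-above-last+1 xs r [] j r-is-last _ _ = <-irrefl (sym (trans (sym (last-++ xs (suc r) [])) r-is-last)) (n<1+n r)
append-above-last+1 xs r (y ∷ ys) j r-is-last r+1<j avoids with last-split y ys
... | zs , e = avoids (map (shift j) xs , map (shift j) zs , [] , [] , shift j (suc r) , shift j r′ , j ,
                       witness , shift-mono {j} r′<r+1 , subst (_< j) (sym (shift-below r+1<j)) r+1<j)
  where
  r′ : ℕ
  r′ = lastEntry (y ∷ ys)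
  r′<r+1 : r′ < suc r
  r′<r+1 = subst (_< suc r) (sym (trans (sym (last-++ xs (suc r) (y ∷ ys))) r-is-last)) (n<1+n r)
  witness : append j (xs ++ suc r ∷ y ∷ ys) ≡ map (shift j) xs ++ shift j (suc r) ∷ map (shift j) zs ++ shift j r′ ∷ [] ++ j ∷ []
  witness = trans (cong (λ t → append j (xs ++ suc r ∷ t)) e) (map-snoc-last (shift j) xs (suc r) zs r′ j)

-- Hence a child is obtained only for j ≤ πₙ + 1 (the entry πₙ + 1 exists when j ≤ n + 1).
appended≤last+1 : ∀ {n π j} → IsPerm n π → j ≤ suc n → Avoids2-1-3 (append j π) → j ≤ suc (lastEntry π)
appended≤last+1 {n} {π} {j} perm j≤n+1 avoids with j ≤? suc (lastEntry π)
... | yes j≤r+1 = j≤r+1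
... | no  j≰r+1 with ∈-∃++ (perm-∈ perm (s≤s z≤n) (≤-pred (≤-trans (≰⇒> j≰r+1) j≤n+1)))
...   | xs , ys , e = ⊥-elim (append-above-last+1 xs (lastEntry π) ys j (cong lastEntry (sym e)) (≰⇒> j≰r+1)
                                (subst (λ t → Avoids2-1-3 (append j t)) e avoids))

-- (⇒, 32-1) If j ≤ h(π), a descent y b of π with bottom b = h(π) becomes a 32-1 y b … j.
maxDescent<appended : ∀ {π j} → 1 ≤ j → Avoids32-1 (append j π) → maxDescent π < j
maxDescent<appended {π} {j} 1≤j avoids with maxDescent π <? j
... | yes h<j = h<j
... | no  h≮j with maxDescent-attained π
...   | inj₁ h≡0 = ⊥-elim (<-irrefl refl (≤-trans 1≤j (subst (j ≤_) h≡0 (≮⇒≥ h≮j))))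
...   | inj₂ (descentAt p₁ y q π≡ b<y) =
        ⊥-elim (avoids (map (shift j) p₁ , map (shift j) q , [] , shift j y , shift j b , j ,
                        trans (cong (append j) π≡) (map-snoc₂ (shift j) p₁ y b q j) ,
                        subst (j <_) (sym (shift-above (≮⇒≥ h≮j))) (s≤s (≮⇒≥ h≮j)) , shift-mono {j} b<y))
  where
  b : ℕ
  b = maxDescent π

-- In a 32-1 avoider every descent bottom b is at most the last entry, since b … πₙ with
-- πₙ < b would be a 32-1.  Hence h(π) ≤ πₙ.
descentBottom≤last : ∀ p₁ y b q → b < y → Avoids32-1 (p₁ ++ y ∷ b ∷ q) → b ≤ lastEntry (p₁ ++ y ∷ b ∷ q)
descentBottom≤last p₁ y b q b<y avoids rewrite last-++ p₁ y (b ∷ q) with b ≤? lastEntry (b ∷ q)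
... | yes b≤r = b≤r
... | no  b≰r with last-split b q
...   | [] , e = ⊥-elim (b≰r (≤-reflexive (proj₁ (∷-injective e))))
...   | _ ∷ zs , e = ⊥-elim (avoids (p₁ , zs , [] , y , b , lastEntry (b ∷ q) ,
                                     cong (λ t → p₁ ++ y ∷ b ∷ t) (proj₂ (∷-injective e)) , ≰⇒> b≰r , b<y))

maxDescent≤last : ∀ π → Avoids32-1 π → maxDescent π ≤ lastEntry π
maxDescent≤last π avoids with maxDescent-attained π
... | inj₁ h≡0 = subst (_≤ lastEntry π) (sym h≡0) z≤n
... | inj₂ (descentAt p₁ y q π≡ b<y) =
  subst (λ t → maxDescent π ≤ lastEntry t) (sym π≡) (descentBottom≤last p₁ y (maxDescent π) q b<y (subst Avoids32-1 π≡ avoids))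

child⇔ : ∀ {n π j} → C n π → 1 ≤ j → j ≤ suc n →
         C (suc n) (append j π) ⇔ (maxDescent π < j × j ≤ suc (lastEntry π))
child⇔ {n} {π} {j} (perm , avoids213 , avoids321) 1≤j j≤n+1 = mk⇔
  (λ (_ , child213 , child321) → maxDescent<appended 1≤j child321 , appended≤last+1 perm j≤n+1 child213)
  (λ (h<j , j≤r+1) → append-IsPerm perm 1≤j j≤n+1 ,
                     append-avoids2-1-3 (perm-unique perm) j≤r+1 avoids213 ,
                     append-avoids32-1 avoids321 h<j)

newBottom-below : ∀ {j r} → j < r → maxList (newBottom j r) ≡ j
newBottom-below {j} j<r rewrite <ᵇ-true j<r = ⊔-identityʳ j

newBottom-above : ∀ {j r} → r ≤ j → maxList (newBottom j r) ≡ 0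
newBottom-above r≤j rewrite <ᵇ-false r≤j = refl

descentBottoms-snoc : ∀ x xs j → descentBottoms ((x ∷ xs) ++ [ j ]) ≡
                      descentBottoms (x ∷ xs) ++ newBottom j (lastEntry (x ∷ xs))
descentBottoms-snoc x []        j = ++-identityʳ _
descentBottoms-snoc x (x′ ∷ xs) j =
  trans (cong (newBottom x′ x ++_) (descentBottoms-snoc x′ xs j))
        (sym (++-assoc (newBottom x′ x) _ _))

descentBottoms-map : ∀ (g : ℕ → ℕ) → (∀ x y → (g x <ᵇ g y) ≡ (x <ᵇ y)) → ∀ xs →
                     descentBottoms (map g xs) ≡ map g (descentBottoms xs)
descentBottoms-map g g-order []             = refl
descentBottoms-map g g-order (x ∷ [])       = refl
descentBottoms-map g g-order (x ∷ y ∷ rest)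
  with g y <ᵇ g x | y <ᵇ x | g-order y x | descentBottoms-map g g-order (y ∷ rest)
... | true  | .true  | refl | ih = cong (g y ∷_) ih
... | false | .false | refl | ih = ih

-- If h(π) < j, the old descent bottoms are unchanged by the shift, so
-- h(append j π) = h(π) ⊔ (j if j < shift j πₙ).
h-append : ∀ x xs j → maxDescent (x ∷ xs) < j →
           h (append j (x ∷ xs)) ≡ maxDescent (x ∷ xs) ⊔ maxList (newBottom j (shift j (lastEntry (x ∷ xs))))
h-append x xs j h<j = begin
  h (append j (x ∷ xs))
    ≡⟨ h≡maxDescent (append j (x ∷ xs)) ⟩
  maxList (descentBottoms (map (shift j) (x ∷ xs) ++ [ j ]))
    ≡⟨ cong maxList (descentBottoms-snoc (shift j x) (map (shift j) xs) j) ⟩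
  maxList (descentBottoms (map (shift j) (x ∷ xs)) ++ newBottom j (lastEntry (map (shift j) (x ∷ xs))))
    ≡⟨ maxList-++ (descentBottoms (map (shift j) (x ∷ xs))) _ ⟩
  maxDescent (map (shift j) (x ∷ xs)) ⊔ maxList (newBottom j (lastEntry (map (shift j) (x ∷ xs))))
    ≡⟨ cong₂ _⊔_ (cong maxList oldBottoms) (cong (λ t → maxList (newBottom j t)) (last-map (shift j) x xs)) ⟩
  maxDescent (x ∷ xs) ⊔ maxList (newBottom j (shift j (lastEntry (x ∷ xs))))
    ∎
  where
  open ≡-Reasoning
  oldBottoms : descentBottoms (map (shift j) (x ∷ xs)) ≡ descentBottoms (x ∷ xs)
  oldBottoms = trans (descentBottoms-map (shift j) (shift-<ᵇ j) (x ∷ xs))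
                     (map-shift-below j (descentBottoms (x ∷ xs)) (λ z z∈ → ≤-<-trans (≤-maxList z∈) h<j))

-- Children with h(π) < j ≤ πₙ get label (j, j): j < πₙ + 1 = shift j πₙ is a new descent
-- bottom exceeding all old ones.
label-append-inner : ∀ π j → maxDescent π < j → j ≤ lastEntry π → label (append j π) ≡ (j , j)
label-append-inner []       zero    () _
label-append-inner []       (suc j) _  ()
label-append-inner (x ∷ xs) j h<j j≤r = cong₂ _,_ newH (last-snoc (map (shift j) (x ∷ xs)) j)
  where
  open ≡-Reasoning
  newH : h (append j (x ∷ xs)) ≡ j
  newH = begin
    h (append j (x ∷ xs))                                          ≡⟨ h-append x xs j h<j ⟩
    maxDescent (x ∷ xs) ⊔ maxList (newBottom j (shift j (lastEntry (x ∷ xs))))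
      ≡⟨ cong (λ t → maxDescent (x ∷ xs) ⊔ maxList (newBottom j t)) (shift-above j≤r) ⟩
    maxDescent (x ∷ xs) ⊔ maxList (newBottom j (suc (lastEntry (x ∷ xs))))
      ≡⟨ cong (maxDescent (x ∷ xs) ⊔_) (newBottom-below (s≤s j≤r)) ⟩
    maxDescent (x ∷ xs) ⊔ j                                        ≡⟨ m≤n⇒m⊔n≡n (<⇒≤ h<j) ⟩
    j                                                              ∎

-- The child with j = πₙ + 1 gets label (h(π), πₙ + 1): πₙ stays below j, no new descent.
label-append-top : ∀ π → maxDescent π ≤ lastEntry π →
                   label (append (suc (lastEntry π)) π) ≡ (maxDescent π , suc (lastEntry π))
label-append-top []       _   = cong₂ _,_ (h≡maxDescent (1 ∷ [])) refl
label-append-top (x ∷ xs) h≤r = cong₂ _,_ newH (last-snoc (map (shift (suc r)) (x ∷ xs)) (suc r))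
  where
  open ≡-Reasoning
  r : ℕ
  r = lastEntry (x ∷ xs)
  newH : h (append (suc r) (x ∷ xs)) ≡ maxDescent (x ∷ xs)
  newH = begin
    h (append (suc r) (x ∷ xs))                                    ≡⟨ h-append x xs (suc r) (s≤s h≤r) ⟩
    maxDescent (x ∷ xs) ⊔ maxList (newBottom (suc r) (shift (suc r) r))
      ≡⟨ cong (λ t → maxDescent (x ∷ xs) ⊔ maxList (newBottom (suc r) t)) (shift-below (n<1+n r)) ⟩
    maxDescent (x ∷ xs) ⊔ maxList (newBottom (suc r) r)            ≡⟨ cong (maxDescent (x ∷ xs) ⊔_) (newBottom-above (n≤1+n r)) ⟩
    maxDescent (x ∷ xs) ⊔ 0                                        ≡⟨ ⊔-identityʳ _ ⟩
    maxDescent (x ∷ xs)                                            ∎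

interval : ℕ → ℕ → List ℕ
interval a m = map (λ i → a + suc i) (upTo m)

∈-interval⁺ : ∀ {a m j} → a < j → j ≤ a + m → j ∈ interval a m
∈-interval⁺ {a} {m} {j} a<j j≤a+m = subst (_∈ interval a m) a+1+i≡j (∈-map⁺ (λ i → a + suc i) (∈-upTo⁺ i<m))
  where
  i = j ∸ suc a
  a+1+i≡j : a + suc i ≡ j
  a+1+i≡j = trans (+-suc a i) (m+[n∸m]≡n a<j)
  i<m : i < m
  i<m = +-cancelˡ-≤ a (suc i) m (subst (_≤ a + m) (sym a+1+i≡j) j≤a+m)

∈-interval⁻ : ∀ {a m j} → j ∈ interval a m → a < j × j ≤ a + m
∈-interval⁻ {a} {m} j∈ with ∈-map⁻ (λ i → a + suc i) j∈
... | i , i∈ , refl = subst (a <_) (sym (+-suc a i)) (s≤s (m≤m+n a i)) , +-monoʳ-≤ a (∈-upTo⁻ i∈)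

interval-unique : ∀ a m → Unique (interval a m)
interval-unique a m = Unique.map⁺ (λ e → suc-injective (+-cancelˡ-≡ a _ _ e)) (Unique.upTo⁺ m)

interval-snoc : ∀ a m → interval a (suc m) ≡ interval a m ++ [ a + suc m ]
interval-snoc a m = trans (cong (map (λ i → a + suc i)) (sym (upTo-∷ʳ m))) (map-++ _ (upTo m) [ m ])

children : List ℕ → List (List ℕ)
children π = map (λ j → append j π) (interval (maxDescent π) (suc (lastEntry π ∸ maxDescent π)))

-- Distinct appended values give distinct children, as the appended value is the last entry.
append-injective : ∀ π {j j′} → append j π ≡ append j′ π → j ≡ j′
append-injective π {j} {j′} e = begin
  j                             ≡⟨ sym (last-snoc (map (shift j) π) j) ⟩
  lastEntry (append j π)        ≡⟨ cong lastEntry e ⟩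
  lastEntry (append j′ π)       ≡⟨ last-snoc (map (shift j′) π) j′ ⟩
  j′                            ∎
  where open ≡-Reasoning

children-unique : ∀ π → Unique (children π)
children-unique π = Unique.map⁺ (append-injective π) (interval-unique _ _)

module _ {n : ℕ} {π : List ℕ} (π∈C : C n π) where
  private
    hπ r k : ℕ
    hπ = maxDescent π
    r  = lastEntry π
    k  = r ∸ hπ
    h≤r : hπ ≤ r
    h≤r = maxDescent≤last π (proj₂ (proj₂ π∈C))
    top : hπ + suc k ≡ suc r
    top = trans (+-suc hπ k) (cong suc (m+[n∸m]≡n h≤r))

  -- Membership in the interval is exactly the condition h < j ≤ r+1 of child⇔.
  children-⇔ : ∀ σ → (σ ∈ children π) ⇔ IsChild n π σ
  children-⇔ σ = mk⇔ to from
    where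
    to : σ ∈ children π → IsChild n π σ
    to σ∈ with ∈-map⁻ (λ j → append j π) σ∈
    ... | j , j∈ , refl with ∈-interval⁻ j∈
    ...   | h<j , j≤h+1+k = j , 1≤j , j≤n+1 , refl , Equivalence.from (child⇔ π∈C 1≤j j≤n+1) (h<j , j≤r+1)
      where
      1≤j : 1 ≤ j
      1≤j = ≤-trans (s≤s z≤n) h<j
      j≤r+1 : j ≤ suc r
      j≤r+1 = subst (j ≤_) top j≤h+1+k
      j≤n+1 : j ≤ suc n
      j≤n+1 = ≤-trans j≤r+1 (s≤s (last≤n (proj₁ π∈C)))
    from : IsChild n π σ → σ ∈ children π
    from (j , 1≤j , j≤n+1 , refl , child) with Equivalence.to (child⇔ π∈C 1≤j j≤n+1) child
    ... | h<j , j≤r+1 = ∈-map⁺ (λ j → append j π) (∈-interval⁺ h<j (subst (j ≤_) (sym top) j≤r+1))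

  children-labels : map label (children π) ≡ childLabels hπ r
  children-labels = begin
    map label (map (λ j → append j π) (interval hπ (suc k)))
      ≡⟨ sym (map-∘ (interval hπ (suc k))) ⟩
    map (λ j → label (append j π)) (interval hπ (suc k))
      ≡⟨ cong (map (λ j → label (append j π))) (interval-snoc hπ k) ⟩
    map (λ j → label (append j π)) (interval hπ k ++ [ hπ + suc k ])
      ≡⟨ map-++ (λ j → label (append j π)) (interval hπ k) [ hπ + suc k ] ⟩
    map (λ j → label (append j π)) (interval hπ k) ++ [ label (append (hπ + suc k) π) ]
      ≡⟨ cong₂ (λ xs x → xs ++ [ x ]) (map-cong-local (All.tabulate inner)) outer ⟩
    map (λ j → (j , j)) (interval hπ k) ++ [ (hπ , suc r) ]
      ≡⟨ cong (_++ [ (hπ , suc r) ]) (sym (map-∘ (upTo k))) ⟩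
    childLabels hπ r
      ∎
    where
    open ≡-Reasoning
    inner : ∀ {j} → j ∈ interval hπ k → label (append j π) ≡ (j , j)
    inner j∈ with ∈-interval⁻ j∈
    ... | h<j , j≤h+k = label-append-inner π _ h<j (subst (_ ≤_) (m+[n∸m]≡n h≤r) j≤h+k)
    outer : label (append (hπ + suc k) π) ≡ (hπ , suc r)
    outer = trans (cong (λ j → label (append j π)) top) (label-append-top π h≤r)

root-avoids2-1-3 : Avoids2-1-3 (1 ∷ [])
root-avoids2-1-3 ([]     , bs , cs , ds , a , b , c , eq , _) = ++-∷≢[] bs b _ (sym (proj₂ (∷-injective eq)))
root-avoids2-1-3 (_ ∷ as , bs , cs , ds , a , b , c , eq , _) = ++-∷≢[] as a _ (sym (proj₂ (∷-injective eq)))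

root-avoids32-1 : Avoids32-1 (1 ∷ [])
root-avoids32-1 ([]     , bs , cs , a , b , c , () , _)
root-avoids32-1 (_ ∷ as , bs , cs , a , b , c , eq , _) = ++-∷≢[] as a _ (sym (proj₂ (∷-injective eq)))

lemma3p3 : (C 1 (1 ∷ []) × label (1 ∷ []) ≡ (0 , 1))
           × ((n : ℕ) → (π : List ℕ) → C n π →
              Σ (List (List ℕ)) λ cs →
                ((σ : List ℕ) → (σ ∈ cs) ⇔ IsChild n π σ)
                × Unique cs
                × (map label cs ↭ childLabels (h π) (lastEntry π)))
lemma3p3 = ((↭-refl , root-avoids2-1-3 , root-avoids32-1) , cong₂ _,_ (h≡maxDescent (1 ∷ [])) refl) ,
           λ n π π∈C → children π , children-⇔ π∈C , children-unique π , ↭-reflexive (labels π π∈C)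
  where
  labels : ∀ {n} π → C n π → map label (children π) ≡ childLabels (h π) (lastEntry π)
  labels π π∈C = trans (children-labels π∈C) (cong (λ t → childLabels t (lastEntry π)) (sym (h≡maxDescent π)))
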